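{- Let $\mathbf{u}$ be either $\mathbf{r}$ or $\mathbf{s}$. Let $w$ be a subword of $\mathbf{u}$ with $|w|\geq 9$, and let $t\geq 3$ be the integer with $2^t+1\leq |w|\leq 2^{t+1}$. If $w$ is a subword of a $2^{t+1}$-aligned block of $\mathbf{u}$, then the position of $w$ in $\mathbf{u}$ is uniquely determined modulo $2^{t+2}$, i.e. all positions at which $w$ occurs in $\mathbf{u}$ are congruent modulo $2^{t+2}$.
   Context: $\mathbf{r}=(r_n)_{n\geq0}$ with $r_n=e_{11}(n)\bmod 2$, where $e_{11}(n)$ is the number of (possibly overlapping) occurrences of $11$ in the binary expansion of $n$; $\mathbf{s}=(s_n)_{n\geq0}$ with $s_n=r_{2n+1}$. For an infinite word $\mathbf{u}=(u_n)_{n\geq 0}$ and $m\geq 1$, the $m$-aligned blocks of $\mathbf{u}$ are the words $u_{mi}u_{mi+1}\cdots u_{m(i+1)-1}$, $i\in\mathbb{N}$. The position of an occurrence $u_n\cdots u_{n+|w|-1}$ of $w$ is $n$. -}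

module Defs where

open import Data.Bool using (Bool; true; false; _∧_; _xor_)
open import Data.Nat using (ℕ; zero; suc; _+_; _*_; _^_; _/_; _%_; _≡ᵇ_)
open import Data.Nat.Properties using (m^n≢0)
open import Data.Fin using (Fin; toℕ)
open import Data.List using (List; tabulate; length; _++_)
open import Data.Product using (Σ; ∃; ∃-syntax; _×_)
open import Relation.Binary.PropositionalEquality using (_≡_)

bit : ℕ → ℕ → Bool
bit i n = ((n / 2 ^ i) ⦃ m^n≢0 2 i ⦄ % 2) ≡ᵇ 1

count11 : ℕ → ℕ → ℕ
count11 zero    n = 0
count11 (suc i) n with bit i n ∧ bit (suc i) n
... | true  = suc (count11 i n)
... | false = count11 i n

-- e₁₁(n): number of (possibly overlapping) occurrences of 11 in the binary
-- expansion of n.  Digits at positions ≥ n are 0, so bound n suffices.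
e11 : ℕ → ℕ
e11 n = count11 n n

parity : ℕ → Bool
parity zero    = false
parity (suc n) = true xor parity n

r : ℕ → Bool
r n = parity (e11 n)

s : ℕ → Bool
s n = r (2 * n + 1)

slice : (ℕ → Bool) → ℕ → ℕ → List Bool
slice u p len = tabulate {n = len} (λ k → u (p + toℕ k))

OccursAt : (ℕ → Bool) → List Bool → ℕ → Set
OccursAt u w p = slice u p (length w) ≡ w

SubwordOf : List Bool → (ℕ → Bool) → Set
SubwordOf w u = ∃[ p ] OccursAt u w p

FactorOf : List Bool → List Bool → Set
FactorOf w v = ∃[ x ] ∃[ y ] v ≡ x ++ w ++ y

alignedBlock : (ℕ → Bool) → ℕ → ℕ → List Bool
alignedBlock u m i = slice u (m * i) m

_≡_mod2^_ : ℕ → ℕ → ℕ → Set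
a ≡ b mod2^ k = (a % 2 ^ k) ⦃ m^n≢0 2 k ⦄ ≡ (b % 2 ^ k) ⦃ m^n≢0 2 k ⦄

module Submission where

-- r, s and their complements form the 2-kernel of r: r(2n) = r(n), r(2n+1) = s(n), s(2n) = r(n) and
-- s(2n+1) = ¬s(n).  Hence the value at 2^K m + j (j < 2^K) of any of these four sequences is determined by
-- the last K binary digits of the position and by r(m), s(m).  An exhaustive check over all such data shows
-- that two equal factors of length 8 occur at positions of equal parity.  Removing this common last digit
-- turns a factor of length 2^t + 1 at p and at a (a inside a 2^(t+1)-aligned block) into a factor of length
-- 2^(t-1) + 1 of another kernel sequence at ⌊p/2⌋ and ⌊a/2⌋, still aligned; so by induction p ≡ a mod 2^(t+2)
-- follows from the case t = 3, which is again an exhaustive check.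

open import Defs
open import Data.Bool using (Bool; true; false; _∧_; _xor_; not; if_then_else_; T)
open import Data.Bool.Properties using (not-involutive; not-injective) renaming (_≟_ to _≟ᵇ_)
open import Data.Fin using (toℕ)
open import Data.List using (List; []; _∷_; _++_; length)
open import Data.List.Properties using (length-++; length-tabulate; tabulate-cong; ∷-injectiveˡ; ∷-injectiveʳ)
open import Data.Nat hiding (parity)
open import Data.Nat.Properties
open import Data.Nat.DivMod
open import Data.Nat.Divisibility using (divides)
open import Data.Nat.Tactic.RingSolver using (solve-∀)
open import Data.Product using (_×_; _,_; ∃-syntax; proj₁; proj₂)
open import Data.Sum using (_⊎_; inj₁; inj₂)
open import Relation.Binary.PropositionalEquality
open import Relation.Nullary.Decidable using (Dec; map′; _×-dec_; _→-dec_; from-yes)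

n<2^n : ∀ n → n < 2 ^ n
n<2^n zero    = s≤s z≤n
n<2^n (suc n) = begin-strict
  suc n         ≡⟨ +-comm 1 n ⟩
  n + 1         <⟨ +-mono-<-≤ (n<2^n n) (m^n>0 2 n) ⟩
  2 ^ n + 2 ^ n ≡⟨ cong (2 ^ n +_) (+-identityʳ (2 ^ n)) ⟨
  2 ^ suc n     ∎
  where open ≤-Reasoning

[2n+e]/2≡n : ∀ n {e} → e < 2 → (2 * n + e) / 2 ≡ n
[2n+e]/2≡n n {e} e<2 = begin
  (2 * n + e) / 2   ≡⟨ +-distrib-/-∣ˡ e (divides n (*-comm 2 n)) ⟩
  2 * n / 2 + e / 2 ≡⟨ cong₂ _+_ (trans (cong (_/ 2) (*-comm 2 n)) (m*n/n≡m n 2)) (m<n⇒m/n≡0 e<2) ⟩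
  n + 0             ≡⟨ +-identityʳ n ⟩
  n                 ∎
  where open ≡-Reasoning

[2n+e]%2≡e : ∀ n {e} → e < 2 → (2 * n + e) % 2 ≡ e
[2n+e]%2≡e n e<2 = trans (%-remove-+ˡ _ (divides n (*-comm 2 n))) (m<n⇒m%n≡m e<2)

2[m/2]+m%2≡m : ∀ m → 2 * (m / 2) + m % 2 ≡ m
2[m/2]+m%2≡m m = begin
  2 * (m / 2) + m % 2 ≡⟨ +-comm (2 * (m / 2)) (m % 2) ⟩
  m % 2 + 2 * (m / 2) ≡⟨ cong (m % 2 +_) (*-comm 2 (m / 2)) ⟩
  m % 2 + m / 2 * 2   ≡⟨ m≡m%n+[m/n]*n m 2 ⟨
  m                   ∎
  where open ≡-Reasoning

2m+e<2n : ∀ {m n e} → m < n → e < 2 → 2 * m + e < 2 * n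
2m+e<2n {m} {n} {e} m<n e<2 = begin-strict
  2 * m + e ≤⟨ +-monoʳ-≤ (2 * m) (<⇒≤pred e<2) ⟩
  2 * m + 1 <⟨ +-monoʳ-< (2 * m) (n<1+n 1) ⟩
  2 * m + 2 ≡⟨ trans (+-comm (2 * m) 2) (sym (*-suc 2 m)) ⟩
  2 * suc m ≤⟨ *-monoʳ-≤ 2 m<n ⟩
  2 * n     ∎
  where open ≤-Reasoning

2x+e+[2y+1]≤4y⇒x+[y+1]≤2y : ∀ x e y → 2 * x + e + (2 * y + 1) ≤ 2 * (2 * y) → x + (y + 1) ≤ 2 * y
2x+e+[2y+1]≤4y⇒x+[y+1]≤2y x e y fits = subst (_≤ 2 * y) (trans (+-comm 1 (x + y)) (+-assoc x y 1))
  (*-cancelˡ-< 2 (x + y) (2 * y) (begin-strict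
    2 * (x + y)             ≡⟨ *-distribˡ-+ 2 x y ⟩
    2 * x + 2 * y           ≤⟨ +-monoˡ-≤ (2 * y) (m≤m+n (2 * x) e) ⟩
    2 * x + e + 2 * y       <⟨ +-monoʳ-< (2 * x + e) (m<m+n (2 * y) (s≤s z≤n)) ⟩
    2 * x + e + (2 * y + 1) ≤⟨ fits ⟩
    2 * (2 * y)             ∎))
  where open ≤-Reasoning

m+k≡n*[m/n]+[m%n+k] : ∀ m n k .⦃ _ : NonZero n ⦄ → m + k ≡ n * (m / n) + (m % n + k)
m+k≡n*[m/n]+[m%n+k] m n k = begin
  m + k                     ≡⟨ cong (_+ k) (m≡m%n+[m/n]*n m n) ⟩
  m % n + m / n * n + k     ≡⟨ cong (_+ k) (+-comm (m % n) (m / n * n)) ⟩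
  m / n * n + m % n + k     ≡⟨ +-assoc (m / n * n) (m % n) k ⟩
  m / n * n + (m % n + k)   ≡⟨ cong (_+ (m % n + k)) (*-comm (m / n) n) ⟩
  n * (m / n) + (m % n + k) ∎
  where open ≡-Reasoning

[2n+e]%[2M]≡2[n%M]+e : ∀ n {e} M .⦃ _ : NonZero M ⦄ .⦃ _ : NonZero (2 * M) ⦄ → e < 2 →
  (2 * n + e) % (2 * M) ≡ 2 * (n % M) + e
[2n+e]%[2M]≡2[n%M]+e n {e} M e<2 = begin
  (2 * n + e) % (2 * M)                         ≡⟨ %-congˡ (cong (λ t → 2 * t + e) (m≡m%n+[m/n]*n n M)) ⟩
  (2 * (n % M + n / M * M) + e) % (2 * M)       ≡⟨ %-congˡ (regroup (n % M) (n / M) M e) ⟩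
  (2 * (n % M) + e + n / M * (2 * M)) % (2 * M) ≡⟨ [m+kn]%n≡m%n (2 * (n % M) + e) (n / M) (2 * M) ⟩
  (2 * (n % M) + e) % (2 * M)                   ≡⟨ m<n⇒m%n≡m (2m+e<2n (m%n<n n M) e<2) ⟩
  2 * (n % M) + e                               ∎
  where
  open ≡-Reasoning
  regroup : ∀ x q M e → 2 * (x + q * M) + e ≡ 2 * x + e + q * (2 * M)
  regroup = solve-∀

m%n+l≤n⇒m%[2n]+l≤2n : ∀ m n l .⦃ _ : NonZero n ⦄ .⦃ _ : NonZero (2 * n) ⦄ →
  m % n + l ≤ n → m % (2 * n) + l ≤ 2 * n
m%n+l≤n⇒m%[2n]+l≤2n m n l m%n+l≤n = begin
  b + l                 ≡⟨ cong (_+ l) (m≡m%n+[m/n]*n b n) ⟩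
  b % n + b / n * n + l ≡⟨ cong (λ t → t + b / n * n + l) (m∣n⇒o%n%m≡o%m n (2 * n) m (divides 2 refl)) ⟩
  m % n + b / n * n + l ≡⟨ swap (m % n) (b / n * n) l ⟩
  m % n + l + b / n * n ≤⟨ +-mono-≤ m%n+l≤n (*-monoˡ-≤ n (<⇒≤pred b/n<2)) ⟩
  2 * n                 ∎
  where
  open ≤-Reasoning
  b = m % (2 * n)
  b/n<2 : b / n < 2
  b/n<2 = m<n*o⇒m/o<n (m%n<n m (2 * n))
  swap : ∀ x y z → x + y + z ≡ x + z + y
  swap = solve-∀

[n*i+x]%n≤x : ∀ n i x .⦃ _ : NonZero n ⦄ → (n * i + x) % n ≤ x
[n*i+x]%n≤x n i x = begin
  (n * i + x) % n ≡⟨ %-congˡ (trans (+-comm (n * i) x) (cong (x +_) (*-comm n i))) ⟩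
  (x + i * n) % n ≡⟨ [m+kn]%n≡m%n x i n ⟩
  x % n           ≤⟨ m%n≤m x n ⟩
  x               ∎
  where open ≤-Reasoning

_/2^_ _%2^_ : ℕ → ℕ → ℕ
p /2^ K = (p / 2 ^ K) ⦃ m^n≢0 2 K ⦄
p %2^ K = (p % 2 ^ K) ⦃ m^n≢0 2 K ⦄

≡-mod2^-suc : ∀ {m n k e} → e < 2 → m ≡ n mod2^ k → (2 * m + e) ≡ (2 * n + e) mod2^ suc k
≡-mod2^-suc {m} {n} {k} {e} e<2 m≡n = begin
  (2 * m + e) %2^ suc k ≡⟨ [2n+e]%[2M]≡2[n%M]+e m (2 ^ k) ⦃ m^n≢0 2 k ⦄ ⦃ m^n≢0 2 (suc k) ⦄ e<2 ⟩
  2 * (m %2^ k) + e     ≡⟨ cong (λ t → 2 * t + e) m≡n ⟩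
  2 * (n %2^ k) + e     ≡⟨ [2n+e]%[2M]≡2[n%M]+e n (2 ^ k) ⦃ m^n≢0 2 k ⦄ ⦃ m^n≢0 2 (suc k) ⦄ e<2 ⟨
  (2 * n + e) %2^ suc k ∎
  where open ≡-Reasoning

indicator : Bool → ℕ
indicator false = 0
indicator true  = 1

bit-zero-digit : ∀ n {e} → e < 2 → bit 0 (2 * n + e) ≡ (e ≡ᵇ 1)
bit-zero-digit n {e} e<2 = cong (_≡ᵇ 1) (trans (cong (_% 2) (n/1≡n (2 * n + e))) ([2n+e]%2≡e n e<2))

bit-suc : ∀ i m → bit (suc i) m ≡ bit i (m / 2)
bit-suc i m = cong (λ q → q % 2 ≡ᵇ 1)
  (sym (m/n/o≡m/[n*o] m 2 (2 ^ i) ⦃ _ ⦄ ⦃ m^n≢0 2 i ⦄ ⦃ m^n≢0 2 (suc i) ⦄))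

bit-vanishes : ∀ {i m} → m < 2 ^ i → bit i m ≡ false
bit-vanishes {i} m<2^i = cong (λ q → q % 2 ≡ᵇ 1) (m<n⇒m/n≡0 ⦃ m^n≢0 2 i ⦄ m<2^i)

count11-suc : ∀ i m → count11 (suc i) m ≡ indicator (bit i m ∧ bit (suc i) m) + count11 i m
count11-suc i m with bit i m ∧ bit (suc i) m
... | true  = refl
... | false = refl

count11-lowest : ∀ i m → count11 (suc i) m ≡ count11 i (m / 2) + indicator (bit 0 m ∧ bit 1 m)
count11-lowest zero    m = trans (count11-suc 0 m) (+-comm _ 0)
count11-lowest (suc i) m = begin
  count11 (suc (suc i)) m
    ≡⟨ count11-suc (suc i) m ⟩
  indicator (bit (suc i) m ∧ bit (suc (suc i)) m) + count11 (suc i) m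
    ≡⟨ cong₂ (λ b b′ → indicator (b ∧ b′) + count11 (suc i) m) (bit-suc i m) (bit-suc (suc i) m) ⟩
  pair + count11 (suc i) m
    ≡⟨ cong (pair +_) (count11-lowest i m) ⟩
  pair + (count11 i (m / 2) + low)
    ≡⟨ +-assoc pair (count11 i (m / 2)) low ⟨
  pair + count11 i (m / 2) + low
    ≡⟨ cong (_+ low) (count11-suc i (m / 2)) ⟨
  count11 (suc i) (m / 2) + low
    ∎
  where
  open ≡-Reasoning
  pair = indicator (bit i (m / 2) ∧ bit (suc i) (m / 2))
  low  = indicator (bit 0 m ∧ bit 1 m)

count11-saturates : ∀ d {i m} → m < 2 ^ i → count11 (d + i) m ≡ count11 i m
count11-saturates zero    m<2^i = refl
count11-saturates (suc d) {i} {m} m<2^i = begin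
  count11 (suc (d + i)) m
    ≡⟨ count11-suc (d + i) m ⟩
  indicator (bit (d + i) m ∧ bit (suc (d + i)) m) + count11 (d + i) m
    ≡⟨ cong (λ b → indicator (b ∧ bit (suc (d + i)) m) + count11 (d + i) m) (bit-vanishes {d + i} m<2^[d+i]) ⟩
  count11 (d + i) m
    ≡⟨ count11-saturates d m<2^i ⟩
  count11 i m
    ∎
  where
  open ≡-Reasoning
  m<2^[d+i] = <-≤-trans m<2^i (^-monoʳ-≤ 2 (m≤n+m i d))

e11≡count11 : ∀ {i m} → m < 2 ^ i → e11 m ≡ count11 i m
e11≡count11 {i} {m} m<2^i = begin
  count11 m m       ≡⟨ count11-saturates i (n<2^n m) ⟨
  count11 (i + m) m ≡⟨ cong (λ j → count11 j m) (+-comm i m) ⟩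
  count11 (m + i) m ≡⟨ count11-saturates m m<2^i ⟩
  count11 i m       ∎
  where open ≡-Reasoning

e11-lowest : ∀ m → e11 m ≡ e11 (m / 2) + indicator (bit 0 m ∧ bit 1 m)
e11-lowest m = begin
  e11 m             ≡⟨ e11≡count11 {suc m} (<-≤-trans (n<2^n m) (^-monoʳ-≤ 2 (n≤1+n m))) ⟩
  count11 (suc m) m ≡⟨ count11-lowest m m ⟩
  count11 m (m / 2) + low ≡⟨ cong (_+ low) (e11≡count11 {m} (≤-<-trans (m/n≤m m 2) (n<2^n m))) ⟨
  e11 (m / 2) + low ∎
  where
  open ≡-Reasoning
  low = indicator (bit 0 m ∧ bit 1 m)

e11-digit : ∀ n {e} → e < 2 → e11 (2 * n + e) ≡ e11 n + indicator ((e ≡ᵇ 1) ∧ bit 0 n)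
e11-digit n {e} e<2 = begin
  e11 (2 * n + e)
    ≡⟨ e11-lowest (2 * n + e) ⟩
  e11 ((2 * n + e) / 2) + indicator (bit 0 (2 * n + e) ∧ bit 1 (2 * n + e))
    ≡⟨ cong₂ (λ m b → e11 m + indicator (b ∧ bit 1 (2 * n + e))) halve (bit-zero-digit n e<2) ⟩
  e11 n + indicator ((e ≡ᵇ 1) ∧ bit 1 (2 * n + e))
    ≡⟨ cong (λ b → e11 n + indicator ((e ≡ᵇ 1) ∧ b)) (trans (bit-suc 0 (2 * n + e)) (cong (bit 0) halve)) ⟩
  e11 n + indicator ((e ≡ᵇ 1) ∧ bit 0 n)
    ∎
  where
  open ≡-Reasoning
  halve = [2n+e]/2≡n n e<2

r[2n]≡r[n] : ∀ n → r (2 * n) ≡ r n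
r[2n]≡r[n] n = cong parity (begin
  e11 (2 * n)     ≡⟨ cong e11 (+-identityʳ (2 * n)) ⟨
  e11 (2 * n + 0) ≡⟨ e11-digit n z<s ⟩
  e11 n + 0       ≡⟨ +-identityʳ (e11 n) ⟩
  e11 n           ∎)
  where open ≡-Reasoning

s[2n]≡r[n] : ∀ n → s (2 * n) ≡ r n
s[2n]≡r[n] n = trans (cong parity (begin
  e11 (2 * (2 * n) + 1)                   ≡⟨ e11-digit (2 * n) (n<1+n 1) ⟩
  e11 (2 * n) + indicator (bit 0 (2 * n)) ≡⟨ cong (λ b → e11 (2 * n) + indicator b) even ⟩
  e11 (2 * n) + 0                         ≡⟨ +-identityʳ (e11 (2 * n)) ⟩
  e11 (2 * n)                             ∎)) (r[2n]≡r[n] n)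
  where
  open ≡-Reasoning
  even = trans (cong (bit 0) (sym (+-identityʳ (2 * n)))) (bit-zero-digit n z<s)

s[2n+1]≡not-s[n] : ∀ n → s (2 * n + 1) ≡ not (s n)
s[2n+1]≡not-s[n] n = cong parity (begin
  e11 (2 * (2 * n + 1) + 1)                       ≡⟨ e11-digit (2 * n + 1) (n<1+n 1) ⟩
  e11 (2 * n + 1) + indicator (bit 0 (2 * n + 1)) ≡⟨ cong (λ b → e11 (2 * n + 1) + indicator b) odd ⟩
  e11 (2 * n + 1) + 1                             ≡⟨ +-comm (e11 (2 * n + 1)) 1 ⟩
  suc (e11 (2 * n + 1))                           ∎)
  where
  open ≡-Reasoning
  odd = bit-zero-digit n (n<1+n 1)

-- (c , x) stands for r if c = false and for s if c = true, complemented if x = true.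
Kernel : Set
Kernel = Bool × Bool

readout : Kernel → Bool × Bool → Bool
readout (c , x) (a , b) = x xor (if c then b else a)

rs : ℕ → Bool × Bool
rs n = r n , s n

seqOf : Kernel → ℕ → Bool
seqOf κ n = readout κ (rs n)

child : Kernel → Bool → Kernel
child (c , x) d = d , (d ∧ c) xor x

seqOf-digit : ∀ κ n {e} → e < 2 → seqOf κ (2 * n + e) ≡ seqOf (child κ (e ≡ᵇ 1)) n
seqOf-digit (false , x)     n {0} _ = cong (x xor_) (trans (cong r (+-identityʳ (2 * n))) (r[2n]≡r[n] n))
seqOf-digit (true  , x)     n {0} _ = cong (x xor_) (trans (cong s (+-identityʳ (2 * n))) (s[2n]≡r[n] n))
seqOf-digit (false , x)     n {1} _ = refl
seqOf-digit (true  , false) n {1} _ = s[2n+1]≡not-s[n] n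
seqOf-digit (true  , true)  n {1} _ = trans (cong not (s[2n+1]≡not-s[n] n)) (not-involutive (s n))
seqOf-digit _               _ {2+ _} (s≤s (s≤s ()))

block : ℕ → Kernel → Bool × Bool → ℕ → Bool
block zero    κ ab _ = readout κ ab
block (suc K) κ ab j = block K (child κ (j % 2 ≡ᵇ 1)) ab (j / 2)

seqOf-block : ∀ K κ m {j} → j < 2 ^ K → seqOf κ (2 ^ K * m + j) ≡ block K κ (rs m) j
seqOf-block zero    κ m {zero}  _ = cong (seqOf κ) (trans (+-identityʳ (1 * m)) (*-identityˡ m))
seqOf-block zero    κ m {suc _} (s≤s ())
seqOf-block (suc K) κ m {j} j<2^[1+K] = begin
  seqOf κ (2 ^ suc K * m + j)                      ≡⟨ cong (seqOf κ) position ⟨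
  seqOf κ (2 * (2 ^ K * m + j / 2) + j % 2)        ≡⟨ seqOf-digit κ (2 ^ K * m + j / 2) (m%n<n j 2) ⟩
  seqOf (child κ (j % 2 ≡ᵇ 1)) (2 ^ K * m + j / 2) ≡⟨ seqOf-block K _ m j/2<2^K ⟩
  block K (child κ (j % 2 ≡ᵇ 1)) (rs m) (j / 2)    ∎
  where
  open ≡-Reasoning
  j/2<2^K : j / 2 < 2 ^ K
  j/2<2^K = m<n*o⇒m/o<n (subst (j <_) (*-comm 2 (2 ^ K)) j<2^[1+K])
  distribute : ∀ M m q e → 2 * (M * m + q) + e ≡ 2 * M * m + (2 * q + e)
  distribute = solve-∀
  position : 2 * (2 ^ K * m + j / 2) + j % 2 ≡ 2 ^ suc K * m + j
  position = trans (distribute (2 ^ K) m (j / 2) (j % 2)) (cong (2 ^ suc K * m +_) (2[m/2]+m%2≡m j))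

window : ℕ → Kernel → Bool × Bool → Bool × Bool → ℕ → Bool
window K κ ab ab′ i = if i <ᵇ 2 ^ K then block K κ ab i else block K κ ab′ (i ∸ 2 ^ K)

seqOf-window : ∀ K κ m {i} → i < 2 * 2 ^ K → seqOf κ (2 ^ K * m + i) ≡ window K κ (rs m) (rs (suc m)) i
seqOf-window K κ m {i} i<2^[1+K] with i <ᵇ 2 ^ K in lt
... | true  = seqOf-block K κ m (<ᵇ⇒< i (2 ^ K) (subst T (sym lt) _))
... | false = trans (cong (seqOf κ) position) (seqOf-block K κ (suc m) (+-cancelˡ-< (2 ^ K) _ _ shifted))
  where
  2^K≤i : 2 ^ K ≤ i
  2^K≤i = ≮⇒≥ (λ i<2^K → subst T lt (<⇒<ᵇ i<2^K))
  position : 2 ^ K * m + i ≡ 2 ^ K * suc m + (i ∸ 2 ^ K)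
  position = begin
    2 ^ K * m + i                     ≡⟨ cong (2 ^ K * m +_) (m+[n∸m]≡n 2^K≤i) ⟨
    2 ^ K * m + (2 ^ K + (i ∸ 2 ^ K)) ≡⟨ +-assoc (2 ^ K * m) (2 ^ K) _ ⟨
    2 ^ K * m + 2 ^ K + (i ∸ 2 ^ K)   ≡⟨ cong (_+ (i ∸ 2 ^ K)) (trans (+-comm (2 ^ K * m) (2 ^ K)) (sym (*-suc (2 ^ K) m))) ⟩
    2 ^ K * suc m + (i ∸ 2 ^ K)       ∎
    where open ≡-Reasoning
  shifted : 2 ^ K + (i ∸ 2 ^ K) < 2 ^ K + 2 ^ K
  shifted = subst₂ _<_ (sym (m+[n∸m]≡n 2^K≤i)) (cong (2 ^ K +_) (+-identityʳ (2 ^ K))) i<2^[1+K]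

seqOf-via-window : ∀ K κ p {k} → k ≤ 2 ^ K →
  seqOf κ (p + k) ≡ window K κ (rs (p /2^ K)) (rs (suc (p /2^ K))) (p %2^ K + k)
seqOf-via-window K κ p {k} k≤2^K = trans
  (cong (seqOf κ) (m+k≡n*[m/n]+[m%n+k] p (2 ^ K) k ⦃ m^n≢0 2 K ⦄))
  (seqOf-window K κ (p /2^ K) (subst (p %2^ K + k <_) (cong (2 ^ K +_) (sym (+-identityʳ (2 ^ K))))
    (+-mono-<-≤ (m%n<n p (2 ^ K) ⦃ m^n≢0 2 K ⦄) k≤2^K)))

seqOf-via-block : ∀ K κ p {k} → p %2^ K + k < 2 ^ K →
  seqOf κ (p + k) ≡ block K κ (rs (p /2^ K)) (p %2^ K + k)
seqOf-via-block K κ p {k} inside = trans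
  (cong (seqOf κ) (m+k≡n*[m/n]+[m%n+k] p (2 ^ K) k ⦃ m^n≢0 2 K ⦄))
  (seqOf-block K κ (p /2^ K) inside)

all-Bool? : {P : Bool → Set} → (∀ b → Dec (P b)) → Dec (∀ b → P b)
all-Bool? P? = map′ (λ (f , t) → λ { false → f ; true → t }) (λ h → h false , h true) (P? false ×-dec P? true)

all-Bool²? : {P : Bool × Bool → Set} → (∀ ab → Dec (P ab)) → Dec (∀ ab → P ab)
all-Bool²? P? = map′ (λ h (a , b) → h a b) (λ h a b → h (a , b)) (all-Bool? λ a → all-Bool? λ b → P? (a , b))

-- The ancestor values rs m are replaced by arbitrary Boolean pairs, so these tables cover every window
-- of every uncomplemented kernel sequence.
parity-table : ∀ c ab ab′ αβ αβ′ {i} → i < 8 → ∀ {j} → j < 8 →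
  (∀ {k} → k < 8 → window 3 (c , false) ab ab′ (i + k) ≡ window 3 (c , false) αβ αβ′ (j + k)) →
  i % 2 ≡ j % 2
parity-table = from-yes
  (all-Bool? λ c → all-Bool²? λ ab → all-Bool²? λ ab′ → all-Bool²? λ αβ → all-Bool²? λ αβ′ →
   allUpTo? (λ i → allUpTo? (λ j →
     allUpTo? (λ k → window 3 (c , false) ab ab′ (i + k) ≟ᵇ window 3 (c , false) αβ αβ′ (j + k)) 8
     →-dec i % 2 ≟ j % 2) 8) 8)

base-table : ∀ c ab ab′ αβ {i} → i < 32 → ∀ {j} → j < 32 → j % 16 + 9 ≤ 16 →
  (∀ {k} → k < 9 → window 5 (c , false) ab ab′ (i + k) ≡ block 5 (c , false) αβ (j + k)) →
  i ≡ j
base-table = from-yes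
  (all-Bool? λ c → all-Bool²? λ ab → all-Bool²? λ ab′ → all-Bool²? λ αβ →
   allUpTo? (λ i → allUpTo? (λ j → j % 16 + 9 ≤? 16 →-dec
     (allUpTo? (λ k → window 5 (c , false) ab ab′ (i + k) ≟ᵇ block 5 (c , false) αβ (j + k)) 9
      →-dec i ≟ j)) 32) 32)

-- A record rather than a Π-type, so that u, p and q can be inferred from an agreement.
record Agree (u : ℕ → Bool) (L p q : ℕ) : Set where
  constructor agreeing
  field at : ∀ {k} → k < L → u (p + k) ≡ u (q + k)
open Agree

Agree-≤ : ∀ {u L L′ p q} → L ≤ L′ → Agree u L′ p q → Agree u L p q
Agree-≤ L≤L′ agree = agreeing λ k<L → at agree (<-≤-trans k<L L≤L′)

Agree-uncomplement : ∀ c x {L p q} → Agree (seqOf (c , x)) L p q → Agree (seqOf (c , false)) L p q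
Agree-uncomplement c false agree = agree
Agree-uncomplement c true  agree = agreeing λ k<L → not-injective (at agree k<L)

Agree-halve : ∀ κ {L P A e} → e < 2 → Agree (seqOf κ) (2 * L + 1) (2 * P + e) (2 * A + e) →
  Agree (seqOf (child κ (e ≡ᵇ 1))) (L + 1) P A
Agree-halve κ {L} {P} {A} {e} e<2 agree = agreeing λ {k} k<L+1 → begin
  seqOf (child κ (e ≡ᵇ 1)) (P + k) ≡⟨ seqOf-digit κ (P + k) e<2 ⟨
  seqOf κ (2 * (P + k) + e)        ≡⟨ cong (seqOf κ) (spread P k e) ⟩
  seqOf κ (2 * P + e + 2 * k)      ≡⟨ at agree (2k<2L+1 k<L+1) ⟩
  seqOf κ (2 * A + e + 2 * k)      ≡⟨ cong (seqOf κ) (spread A k e) ⟨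
  seqOf κ (2 * (A + k) + e)        ≡⟨ seqOf-digit κ (A + k) e<2 ⟩
  seqOf (child κ (e ≡ᵇ 1)) (A + k) ∎
  where
  open ≡-Reasoning
  spread : ∀ X k e → 2 * (X + k) + e ≡ 2 * X + e + 2 * k
  spread = solve-∀
  2k<2L+1 : ∀ {k} → k < L + 1 → 2 * k < 2 * L + 1
  2k<2L+1 {k} k<L+1 = subst (2 * k <_) (+-comm 1 (2 * L))
    (s≤s (*-monoʳ-≤ 2 (m<1+n⇒m≤n (subst (k <_) (+-comm L 1) k<L+1))))

agreement-fixes-parity : ∀ κ {p a} → Agree (seqOf κ) 8 p a → p % 2 ≡ a % 2
agreement-fixes-parity (c , x) {p} {a} agree = begin
  p % 2     ≡⟨ m∣n⇒o%n%m≡o%m 2 8 p (divides 4 refl) ⟨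
  p % 8 % 2 ≡⟨ parity-table c _ _ _ _ (m%n<n p 8) (m%n<n a 8) windows ⟩
  a % 8 % 2 ≡⟨ m∣n⇒o%n%m≡o%m 2 8 a (divides 4 refl) ⟩
  a % 2     ∎
  where
  open ≡-Reasoning
  windows : ∀ {k} → k < 8 → window 3 (c , false) (rs (p / 8)) (rs (suc (p / 8))) (p % 8 + k)
                          ≡ window 3 (c , false) (rs (a / 8)) (rs (suc (a / 8))) (a % 8 + k)
  windows {k} k<8 = begin
    window 3 (c , false) (rs (p / 8)) (rs (suc (p / 8))) (p % 8 + k) ≡⟨ seqOf-via-window 3 _ p (<⇒≤ k<8) ⟨
    seqOf (c , false) (p + k)                                         ≡⟨ at (Agree-uncomplement c x agree) k<8 ⟩
    seqOf (c , false) (a + k)                                         ≡⟨ seqOf-via-window 3 _ a (<⇒≤ k<8) ⟩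
    window 3 (c , false) (rs (a / 8)) (rs (suc (a / 8))) (a % 8 + k) ∎

aligned-agreement-fixes-mod32 : ∀ κ {p a} → a % 16 + 9 ≤ 16 → Agree (seqOf κ) 9 p a → p % 32 ≡ a % 32
aligned-agreement-fixes-mod32 (c , x) {p} {a} aligned agree =
  base-table c _ _ _ (m%n<n p 32) (m%n<n a 32) aligned₁₆ windows
  where
  open ≡-Reasoning
  aligned₁₆ : a % 32 % 16 + 9 ≤ 16
  aligned₁₆ = subst (λ m → m + 9 ≤ 16) (sym (m∣n⇒o%n%m≡o%m 16 32 a (divides 2 refl))) aligned
  k≤32 : ∀ {k} → k < 9 → k ≤ 32
  k≤32 k<9 = ≤-trans (<⇒≤ k<9) (m≤m+n 9 23)
  inside : ∀ {k} → k < 9 → a % 32 + k < 32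
  inside k<9 = <-≤-trans (+-monoʳ-< (a % 32) k<9) (m%n+l≤n⇒m%[2n]+l≤2n a 16 9 aligned)
  windows : ∀ {k} → k < 9 → window 5 (c , false) (rs (p / 32)) (rs (suc (p / 32))) (p % 32 + k)
                          ≡ block 5 (c , false) (rs (a / 32)) (a % 32 + k)
  windows {k} k<9 = begin
    window 5 (c , false) (rs (p / 32)) (rs (suc (p / 32))) (p % 32 + k) ≡⟨ seqOf-via-window 5 _ p (k≤32 k<9) ⟨
    seqOf (c , false) (p + k)                                           ≡⟨ at (Agree-uncomplement c x agree) k<9 ⟩
    seqOf (c , false) (a + k)                                           ≡⟨ seqOf-via-block 5 _ a (inside k<9) ⟩
    block 5 (c , false) (rs (a / 32)) (a % 32 + k)                      ∎

aligned-agreement-fixes-position : ∀ n κ {p a} → a %2^ (4 + n) + (2 ^ (3 + n) + 1) ≤ 2 ^ (4 + n) →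
  Agree (seqOf κ) (2 ^ (3 + n) + 1) p a → p ≡ a mod2^ (5 + n)
aligned-agreement-fixes-position zero    κ aligned agree = aligned-agreement-fixes-mod32 κ aligned agree
aligned-agreement-fixes-position (suc n) κ {p} {a} aligned agree =
  subst₂ (λ p a → p ≡ a mod2^ (6 + n)) p≡2P+e a≡2A+e
    (≡-mod2^-suc {k = 5 + n} e<2 (aligned-agreement-fixes-position n (child κ (e ≡ᵇ 1)) aligned′ agree′))
  where
  e = a % 2
  e<2 = m%n<n a 2
  a≡2A+e : 2 * (a / 2) + e ≡ a
  a≡2A+e = 2[m/2]+m%2≡m a
  8≤L : 8 ≤ 2 ^ (4 + n) + 1
  8≤L = ≤-trans (^-monoʳ-≤ 2 {3} {4 + n} (s≤s (s≤s (s≤s z≤n)))) (m≤m+n (2 ^ (4 + n)) 1)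
  p≡2P+e : 2 * (p / 2) + e ≡ p
  p≡2P+e = trans (cong (2 * (p / 2) +_) (sym (agreement-fixes-parity κ (Agree-≤ 8≤L agree)))) (2[m/2]+m%2≡m p)
  agree′ : Agree (seqOf (child κ (e ≡ᵇ 1))) (2 ^ (3 + n) + 1) (p / 2) (a / 2)
  agree′ = Agree-halve κ e<2 (subst₂ (Agree (seqOf κ) (2 ^ (4 + n) + 1)) (sym p≡2P+e) (sym a≡2A+e) agree)
  a%2^[5+n] : a %2^ (5 + n) ≡ 2 * ((a / 2) %2^ (4 + n)) + e
  a%2^[5+n] = trans (cong (_%2^ (5 + n)) (sym a≡2A+e))
    ([2n+e]%[2M]≡2[n%M]+e (a / 2) (2 ^ (4 + n)) ⦃ m^n≢0 2 (4 + n) ⦄ ⦃ m^n≢0 2 (5 + n) ⦄ e<2)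
  aligned′ : (a / 2) %2^ (4 + n) + (2 ^ (3 + n) + 1) ≤ 2 ^ (4 + n)
  aligned′ = 2x+e+[2y+1]≤4y⇒x+[y+1]≤2y ((a / 2) %2^ (4 + n)) e (2 ^ (3 + n))
    (subst (λ m → m + (2 ^ (4 + n) + 1) ≤ 2 ^ (5 + n)) a%2^[5+n] aligned)

slice-suc : ∀ u p L → slice u p (suc L) ≡ u p ∷ slice u (suc p) L
slice-suc u p L = cong₂ _∷_ (cong u (+-identityʳ p)) (tabulate-cong λ k → cong u (+-suc p (toℕ k)))

slice-+ : ∀ u p m n → slice u p (m + n) ≡ slice u p m ++ slice u (p + m) n
slice-+ u p zero    n = cong (λ q → slice u q n) (sym (+-identityʳ p))
slice-+ u p (suc m) n = begin
  slice u p (suc (m + n))                            ≡⟨ slice-suc u p (m + n) ⟩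
  u p ∷ slice u (suc p) (m + n)                      ≡⟨ cong (u p ∷_) (slice-+ u (suc p) m n) ⟩
  u p ∷ (slice u (suc p) m ++ slice u (suc p + m) n) ≡⟨ cong (λ q → u p ∷ slice u (suc p) m ++ slice u q n) (+-suc p m) ⟨
  u p ∷ (slice u (suc p) m ++ slice u (p + suc m) n) ≡⟨ cong (_++ slice u (p + suc m) n) (slice-suc u p m) ⟨
  slice u p (suc m) ++ slice u (p + suc m) n         ∎
  where open ≡-Reasoning

++-injective : ∀ {A : Set} (xs xs′ : List A) {ys ys′} → length xs ≡ length xs′ →
  xs ++ ys ≡ xs′ ++ ys′ → xs ≡ xs′ × ys ≡ ys′
++-injective []       []         _   eq = refl , eq
++-injective (x ∷ xs) (x′ ∷ xs′) len eq =
  let xs≡xs′ , ys≡ys′ = ++-injective xs xs′ (suc-injective len) (∷-injectiveʳ eq)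
  in cong₂ _∷_ (∷-injectiveˡ eq) xs≡xs′ , ys≡ys′

slice-≡⇒Agree : ∀ {u p q} L → slice u p L ≡ slice u q L → Agree u L p q
slice-≡⇒Agree zero    _ = agreeing λ ()
slice-≡⇒Agree {u} {p} {q} (suc L) eq = agreeing agree
  where
  open ≡-Reasoning
  tails : Agree u L (suc p) (suc q)
  tails = slice-≡⇒Agree L (∷-injectiveʳ (trans (sym (slice-suc u p L)) (trans eq (slice-suc u q L))))
  agree : ∀ {k} → k < suc L → u (p + k) ≡ u (q + k)
  agree {zero}  _         = ∷-injectiveˡ eq
  agree {suc k} (s≤s k<L) = begin
    u (p + suc k) ≡⟨ cong u (+-suc p k) ⟩
    u (suc p + k) ≡⟨ at tails k<L ⟩
    u (suc q + k) ≡⟨ cong u (+-suc q k) ⟨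
    u (q + suc k) ∎

occurrences-agree : ∀ {u w p q} → OccursAt u w p → OccursAt u w q → Agree u (length w) p q
occurrences-agree occ-p occ-q = slice-≡⇒Agree _ (trans occ-p (sym occ-q))

factor-of-aligned-block : ∀ u M i w .⦃ _ : NonZero M ⦄ → FactorOf w (alignedBlock u M i) →
  ∃[ a ] OccursAt u w a × a % M + length w ≤ M
factor-of-aligned-block u M i w (xs , ys , split) = a , occurs , fits
  where
  open ≡-Reasoning
  a = M * i + length xs
  M≡ : M ≡ length xs + (length w + length ys)
  M≡ = begin
    M                                  ≡⟨ length-tabulate _ ⟨
    length (alignedBlock u M i)        ≡⟨ cong length split ⟩
    length (xs ++ w ++ ys)             ≡⟨ length-++ xs ⟩
    length xs + length (w ++ ys)       ≡⟨ cong (length xs +_) (length-++ w) ⟩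
    length xs + (length w + length ys) ∎
  pieces : slice u (M * i) (length xs) ++ slice u a (length w) ++ slice u (a + length w) (length ys) ≡ xs ++ w ++ ys
  pieces = begin
    slice u (M * i) (length xs) ++ slice u a (length w) ++ slice u (a + length w) (length ys)
      ≡⟨ cong (slice u (M * i) (length xs) ++_) (slice-+ u a (length w) (length ys)) ⟨
    slice u (M * i) (length xs) ++ slice u a (length w + length ys)
      ≡⟨ slice-+ u (M * i) (length xs) (length w + length ys) ⟨
    slice u (M * i) (length xs + (length w + length ys))
      ≡⟨ subst (λ L → slice u (M * i) L ≡ xs ++ w ++ ys) M≡ split ⟩
    xs ++ w ++ ys
      ∎
  occurs : OccursAt u w a
  occurs = proj₁ (++-injective (slice u a (length w)) w (length-tabulate _)
    (proj₂ (++-injective (slice u (M * i) (length xs)) xs (length-tabulate _) pieces)))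
  fits : a % M + length w ≤ M
  fits = subst (a % M + length w ≤_) (sym M≡) (≤-trans
    (+-monoˡ-≤ (length w) ([n*i+x]%n≤x M i (length xs)))
    (+-monoʳ-≤ (length xs) (m≤m+n (length w) (length ys))))

aligned-factor-fixes-position : ∀ κ (w : List Bool) t → 3 ≤ t → 2 ^ t + 1 ≤ length w →
  ∃[ i ] FactorOf w (alignedBlock (seqOf κ) (2 ^ (t + 1)) i) →
  ∀ p q → OccursAt (seqOf κ) w p → OccursAt (seqOf κ) w q → p ≡ q mod2^ (t + 2)
aligned-factor-fixes-position κ w (suc (suc (suc n))) (s≤s (s≤s (s≤s _))) long (i , factor) p q occ-p occ-q
  with factor-of-aligned-block (seqOf κ) (2 ^ (4 + n)) i w ⦃ m^n≢0 2 (4 + n) ⦄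
         (subst (λ e → FactorOf w (alignedBlock (seqOf κ) (2 ^ e) i)) (+-comm (3 + n) 1) factor)
... | a , occ-a , fits = subst (p ≡ q mod2^_) (+-comm 2 (3 + n)) (trans (fixes occ-p) (sym (fixes occ-q)))
  where
  fixes : ∀ {p} → OccursAt (seqOf κ) w p → p ≡ a mod2^ (5 + n)
  fixes occ = aligned-agreement-fixes-position n κ (≤-trans (+-monoʳ-≤ (a %2^ (4 + n)) long) fits)
    (Agree-≤ long (occurrences-agree occ occ-a))

-- 9 ≤ |w| follows from 3 ≤ t.
lemma4p4 : (u : ℕ → Bool) → (u ≡ r ⊎ u ≡ s) →
    (w : List Bool) → SubwordOf w u → 9 ≤ length w →
    (t : ℕ) → 3 ≤ t → 2 ^ t + 1 ≤ length w → length w ≤ 2 ^ (t + 1) →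
    (∃[ i ] FactorOf w (alignedBlock u (2 ^ (t + 1)) i)) →
    (p q : ℕ) → OccursAt u w p → OccursAt u w q →
    p ≡ q mod2^ (t + 2)
lemma4p4 u (inj₁ refl) w _ _ t 3≤t long _ = aligned-factor-fixes-position (false , false) w t 3≤t long
lemma4p4 u (inj₂ refl) w _ _ t 3≤t long _ = aligned-factor-fixes-position (true , false) w t 3≤t long
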